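{- Let $x\ge4$ be an integer such that $N=\binom{x}{\lfloor x/2\rfloor}$ is even, and let $\mathcal E_N$ be the graph on $N$ vertices consisting of $N/2$ pairwise disjoint edges. Then $t(\mathcal E_N)=x+1=t_e(\mathcal E_N)+2$.
   Context: For a finite simple graph $G$, a family of subsets $B_v\subseteq[1,t]=\{1,\dots,t\}$, one for each vertex $v$, is a $G$-ECFF$(t,|V(G)|)$ if for every edge $\{a,b\}$ and every vertex $w\notin\{a,b\}$, $B_w\not\subseteq B_a\cup B_b$; it is a $G$-CFF$(t,|V(G)|)$ if in addition $B_a\not\subseteq B_b$ and $B_b\not\subseteq B_a$ for every edge $\{a,b\}$. $t_e(G)$ and $t(G)$ denote the minimum $t$ for which a $G$-ECFF, respectively a $G$-CFF, on $|V(G)|$ sets exists. -}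

module Defs where

open import Data.Nat using (ℕ; _≤_; _/_)
open import Data.Fin using (Fin; toℕ)
open import Data.Fin.Subset using (Subset; _⊆_; _∪_)
open import Data.Product using (Σ; _×_; _,_)
open import Relation.Binary.PropositionalEquality using (_≡_; _≢_; sym)
open import Relation.Nullary using (¬_)

record Graph (n : ℕ) : Set₁ where
  field
    Adj   : Fin n → Fin n → Set
    adj-sym : ∀ {a b} → Adj a b → Adj b a
    irrefl : ∀ {a} → ¬ Adj a a

open Graph public

Family : ℕ → ℕ → Set
Family n t = Fin n → Subset t

IsECFF : ∀ {n t} → Graph n → Family n t → Set
IsECFF G B = ∀ a b w → Adj G a b → w ≢ a → w ≢ b → ¬ (B w ⊆ (B a ∪ B b))

IsCFF : ∀ {n t} → Graph n → Family n t → Set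
IsCFF G B = IsECFF G B × (∀ a b → Adj G a b → ¬ (B a ⊆ B b) × ¬ (B b ⊆ B a))

IsMinimum : (ℕ → Set) → ℕ → Set
IsMinimum P m = P m × (∀ t → P t → m ≤ t)

IsTe : ∀ {n} → Graph n → ℕ → Set
IsTe {n} G = IsMinimum (λ t → Σ (Family n t) (λ B → IsECFF G B))

IsT : ∀ {n} → Graph n → ℕ → Set
IsT {n} G = IsMinimum (λ t → Σ (Family n t) (λ B → IsCFF G B))

-- The perfect matching graph E_N on vertices Fin N (N even):
-- edges {2i, 2i+1}, i.e. a ~ b iff a ≠ b and ⌊a/2⌋ = ⌊b/2⌋.
matchAdj : ∀ {N} → Fin N → Fin N → Set
matchAdj a b = (a ≢ b) × (toℕ a / 2 ≡ toℕ b / 2)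

matching : (N : ℕ) → Graph N
matching N = record
  { Adj = matchAdj
  ; adj-sym = λ { (ne , eq) → (λ e → ne (sym e)) , sym eq }
  ; irrefl = λ { (ne , _) → ne _≡_.refl }
  }

-- Lubell's form of Sperner's theorem is proved by counting maximal chains of subsets of [n]: a
-- set p lies on |p|! (n - |p|)! ≥ ⌊n/2⌋! ⌈n/2⌉! of them. For any list of sets, the sum of these
-- counts minus the counts of chains through pairs of listed sets is at most n! (a Bonferroni
-- inequality, by induction on n after classifying chains by their last element); for an antichain
-- the pair terms vanish, so it has at most (n choose ⌊n/2⌋) members.
--
-- Let N = (x choose ⌊x/2⌋). In a CFF for the matching E_N all N sets form an antichain. Adding
-- to them the union U of the two sets of an edge, which contains no other set, makes the count
-- strict (if |U| = 2, because the singleton sets lie on more than ⌊x/2⌋! ⌈x/2⌉! chains), so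
-- t ≥ x + 1. In an ECFF the sets of one endpoint per edge form an antichain of size N/2 >
-- (x-2 choose ⌊(x-2)/2⌋), so t ≥ x - 1. Conversely N/2 ≤ (x-1 choose ⌊(x-1)/2⌋), so giving both
-- endpoints of the k-th edge the k-th set of the middle layer of [x-1] is an ECFF, and prefixing
-- the singleton of the endpoint's parity makes it a CFF on x + 1 points.

module Submission where

open import Defs
open import Data.Nat using (ℕ; _≤_; _+_; _/_)
open import Data.Nat.Combinatorics using (_C_)
open import Data.Nat.Divisibility using (_∣_)
open import Data.Product using (Σ; _×_)
open import Relation.Binary.PropositionalEquality using (_≡_)

open import Data.Bool.Base using (true; false; if_then_else_; _∨_)
open import Data.Empty using (⊥-elim)
open import Data.Fin.Base using (Fin; zero; suc; toℕ; inject≤; combine; quotient; remainder; opposite)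
open import Data.Fin.Properties
  using (toℕ-injective; toℕ<n; toℕ-combine; remQuot-combine; combine-remQuot;
         combine-injectiveˡ; combine-injectiveʳ; inject≤-injective)
import Data.Fin.Properties as Finₚ
open import Data.Fin.Subset using (Subset; inside; outside; _∈_; _⊆_; _⊈_; _∪_; _─_; _-_; ∁; ∣_∣; ⊤; ⁅_⁆)
open import Data.Fin.Subset.Properties
  using (_⊆?_; _∈?_; drop-∷-⊆; ⊆-antisym; ⊆-trans; ⊆⊤; ∣⊤∣≡n; p⊆p∪q; q⊆p∪q; ∪-idem; x∈⁅x⁆;
         x∈⁅y⁆⇒x≡y; x∈p⇒∣p-x∣<∣p∣; x∈p∧x∉q⇒x∈p─q; p⊆q⇒∣p∣≤∣q∣)
open import Data.List.Base as List using (List; []; _∷_; map; tabulate; _++_; length)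
open import Data.List.Properties using (map-cong; map-cong-local; length-map; length-++)
open import Data.List.Membership.Propositional.Properties using (∈-lookup)
open import Data.List.Relation.Unary.All as All using (All; []; _∷_)
import Data.List.Relation.Unary.All.Properties as All
open import Data.List.Relation.Unary.AllPairs as AllPairs using (AllPairs; []; _∷_)
import Data.List.Relation.Unary.AllPairs.Properties as AllPairs
open import Data.List.Relation.Unary.Any using (Any; here; there)
open import Data.Nat.Base
  using (zero; suc; pred; _*_; _∸_; _<_; z≤n; s≤s; _!; ⌊_/2⌋; ⌈_/2⌉; NonZero; ≢-nonZero⁻¹)
open import Data.Nat.Combinatorics using (nCk≡n!/k![n-k]!; k![n∸k]!∣n!; nCk+nC[k+1]≡[n+1]C[k+1])
open import Data.Nat.DivMod using (m/n*n≡m; m/n≡1+[m∸n]/n; +-distrib-/-∣ˡ; m*n/n≡m; m<n⇒m/n≡0; /-congˡ)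
open import Data.Nat.Divisibility using (divides; m∣m*n)
open import Data.Nat.ListAction using (sum)
open import Data.Nat.Properties
open import Algebra.Properties.CommutativeMonoid.Sum +-0-commutativeMonoid
  using (sum-syntax; ∑-distrib-+; sum-cong-≗; sum-replicate-zero)
open import Algebra.Properties.CommutativeSemigroup *-commutativeSemigroup using (x∙yz≈y∙xz)
open import Algebra.Properties.CommutativeSemigroup +-commutativeSemigroup
  using () renaming (x∙yz≈y∙xz to m+[n+o]≡n+[m+o])
open import Data.Nat.Tactic.RingSolver using (solve-∀)
open import Data.Product.Base using (∃; ∃-syntax; Σ-syntax; _,_; proj₁; proj₂)
open import Data.Sum.Base using (_⊎_; inj₁; inj₂; [_,_]′)
open import Data.Vec.Base using ([]; _∷_; lookup; removeAt; here; there) renaming (_++_ to _++ᵛ_)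
open import Data.Vec.Properties using ([]=⇒lookup; lookup⇒[]=; zipWith-++)
open import Function.Base using (_∘_; case_of_)
open import Relation.Binary.Core using (Rel)
open import Relation.Binary.Definitions using (Symmetric)
open import Relation.Binary.PropositionalEquality
  using (_≢_; refl; sym; trans; cong; cong₂; subst; subst₂; module ≡-Reasoning)
open import Relation.Nullary using (¬_; yes; no; contradiction)

private variable
  A : Set
  m n N : ℕ

-- Central binomial coefficients

n/2≡⌊n/2⌋ : ∀ n → n / 2 ≡ ⌊ n /2⌋
n/2≡⌊n/2⌋ zero = refl
n/2≡⌊n/2⌋ (suc zero) = refl
n/2≡⌊n/2⌋ (suc (suc n)) =
  trans (m/n≡1+[m∸n]/n {suc (suc n)} {2} (s≤s (s≤s z≤n))) (cong suc (n/2≡⌊n/2⌋ n))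

⌈n/2⌉≤1+⌊n/2⌋ : ∀ n → ⌈ n /2⌉ ≤ suc ⌊ n /2⌋
⌈n/2⌉≤1+⌊n/2⌋ zero = z≤n
⌈n/2⌉≤1+⌊n/2⌋ (suc zero) = s≤s z≤n
⌈n/2⌉≤1+⌊n/2⌋ (suc (suc n)) = s≤s (⌈n/2⌉≤1+⌊n/2⌋ n)

even⊎odd : ∀ n → ∃[ m ] (n ≡ m + m ⊎ n ≡ suc (m + m))
even⊎odd zero = 0 , inj₁ refl
even⊎odd (suc n) with even⊎odd n
... | m , inj₁ refl = m , inj₂ refl
... | m , inj₂ refl = suc m , inj₁ (cong suc (sym (+-suc m m)))

central : ℕ → ℕ
central n = n C ⌊ n /2⌋

-- The number of maximal chains of subsets of an n-set through a fixed set of size ⌊n/2⌋.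
midChains : ℕ → ℕ
midChains n = ⌊ n /2⌋ ! * ⌈ n /2⌉ !

midChains≢0 : ∀ n → NonZero (midChains n)
midChains≢0 n = ⌊ n /2⌋ !* ⌈ n /2⌉ !≢0

central*midChains≡n! : ∀ n → central n * midChains n ≡ n !
central*midChains≡n! n = begin
  central n * midChains n              ≡⟨ cong (λ k → central n * (⌊ n /2⌋ ! * k !)) ⌈n/2⌉≡n∸⌊n/2⌋ ⟩
  (n C ⌊ n /2⌋) * d                    ≡⟨ cong (_* d) (nCk≡n!/k![n-k]! (⌊n/2⌋≤n n)) ⟩
  (n ! / d) {{d≢0}} * d                ≡⟨ m/n*n≡m {{d≢0}} (k![n∸k]!∣n! (⌊n/2⌋≤n n)) ⟩
  n !                                  ∎
  where
  open ≡-Reasoning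
  d = ⌊ n /2⌋ ! * (n ∸ ⌊ n /2⌋) !
  d≢0 = ⌊ n /2⌋ !* (n ∸ ⌊ n /2⌋) !≢0
  ⌈n/2⌉≡n∸⌊n/2⌋ : ⌈ n /2⌉ ≡ n ∸ ⌊ n /2⌋
  ⌈n/2⌉≡n∸⌊n/2⌋ = trans (sym (m+n∸m≡n ⌊ n /2⌋ ⌈ n /2⌉)) (cong (_∸ ⌊ n /2⌋) (⌊n/2⌋+⌈n/2⌉≡n n))

central≢0 : ∀ n → NonZero (central n)
central≢0 n = m*n≢0⇒m≢0 (central n) {{subst NonZero (sym (central*midChains≡n! n)) (n !≢0)}}

midChains-suc : ∀ n → midChains (suc n) ≡ suc ⌊ n /2⌋ * midChains n
midChains-suc n = trans (x∙yz≈y∙xz (⌈ n /2⌉ !) (suc ⌊ n /2⌋) (⌊ n /2⌋ !))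
  (cong (suc ⌊ n /2⌋ *_) (*-comm (⌈ n /2⌉ !) (⌊ n /2⌋ !)))

-- Both sides times midChains n equal (suc n)!.
central-suc : ∀ n → central (suc n) * suc ⌊ n /2⌋ ≡ suc n * central n
central-suc n =
  *-cancelʳ-≡ (central (suc n) * suc ⌊ n /2⌋) (suc n * central n) (midChains n) {{midChains≢0 n}} (begin
  central (suc n) * suc ⌊ n /2⌋ * midChains n    ≡⟨ *-assoc (central (suc n)) (suc ⌊ n /2⌋) (midChains n) ⟩
  central (suc n) * (suc ⌊ n /2⌋ * midChains n)  ≡⟨ cong (central (suc n) *_) (midChains-suc n) ⟨
  central (suc n) * midChains (suc n)            ≡⟨ central*midChains≡n! (suc n) ⟩
  suc n * n !                                    ≡⟨ cong (suc n *_) (central*midChains≡n! n) ⟨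
  suc n * (central n * midChains n)              ≡⟨ *-assoc (suc n) (central n) (midChains n) ⟨
  suc n * central n * midChains n                ∎)
  where open ≡-Reasoning

central-≤-suc : ∀ n → central n ≤ central (suc n)
central-≤-suc n = *-cancelʳ-≤ (central n) (central (suc n)) (suc ⌊ n /2⌋) (begin
  central n * suc ⌊ n /2⌋        ≡⟨ *-comm (central n) (suc ⌊ n /2⌋) ⟩
  suc ⌊ n /2⌋ * central n        ≤⟨ *-monoˡ-≤ (central n) (s≤s (⌊n/2⌋≤n n)) ⟩
  suc n * central n              ≡⟨ central-suc n ⟨
  central (suc n) * suc ⌊ n /2⌋  ∎)
  where open ≤-Reasoning

central-<-suc : ∀ n → central (suc n) < central (2 + n)
central-<-suc n = *-cancelʳ-< (suc ⌊ suc n /2⌋) (central (suc n)) (central (2 + n)) (begin-strict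
  central (suc n) * suc ⌊ suc n /2⌋   ≡⟨ *-comm (central (suc n)) (suc ⌊ suc n /2⌋) ⟩
  suc ⌊ suc n /2⌋ * central (suc n)   <⟨ *-monoˡ-< (central (suc n)) {{central≢0 (suc n)}} (s≤s (⌊n/2⌋<n n)) ⟩
  (2 + n) * central (suc n)           ≡⟨ central-suc (suc n) ⟨
  central (2 + n) * suc ⌊ suc n /2⌋   ∎)
  where open ≤-Reasoning

central-mono-≤ : ∀ {m n} → m ≤ n → central m ≤ central n
central-mono-≤ {n = zero} z≤n = ≤-refl
central-mono-≤ {m} {suc n} m≤1+n with m≤n⇒m<n∨m≡n m≤1+n
... | inj₁ m<1+n = ≤-trans (central-mono-≤ (≤-pred m<1+n)) (central-≤-suc n)
... | inj₂ refl = ≤-refl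

central-suc≤2*central : ∀ n → central (suc n) ≤ 2 * central n
central-suc≤2*central n = *-cancelʳ-≤ (central (suc n)) (2 * central n) (suc ⌊ n /2⌋) (begin
  central (suc n) * suc ⌊ n /2⌋           ≡⟨ central-suc n ⟩
  suc n * central n                       ≤⟨ *-monoˡ-≤ (central n) 1+n≤2+2⌊n/2⌋ ⟩
  (suc ⌊ n /2⌋ + suc ⌊ n /2⌋) * central n ≡⟨ [a+a]*c≡2*c*a (suc ⌊ n /2⌋) (central n) ⟩
  2 * central n * suc ⌊ n /2⌋             ∎)
  where
  open ≤-Reasoning
  [a+a]*c≡2*c*a : ∀ a c → (a + a) * c ≡ 2 * c * a
  [a+a]*c≡2*c*a = solve-∀
  1+n≤2+2⌊n/2⌋ : suc n ≤ suc ⌊ n /2⌋ + suc ⌊ n /2⌋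
  1+n≤2+2⌊n/2⌋ = subst (_≤ suc ⌊ n /2⌋ + suc ⌊ n /2⌋) (cong suc (⌊n/2⌋+⌈n/2⌉≡n n))
                       (s≤s (+-monoʳ-≤ ⌊ n /2⌋ (⌈n/2⌉≤1+⌊n/2⌋ n)))

central[2+2m]≡2*central[1+2m] : ∀ m → central (2 + (m + m)) ≡ 2 * central (1 + (m + m))
central[2+2m]≡2*central[1+2m] m = *-cancelʳ-≡ (central (2 + (m + m))) (2 * central (1 + (m + m))) (suc m) (begin
  central (2 + (m + m)) * suc m                  ≡⟨ cong (λ k → central (2 + (m + m)) * suc k) (n≡⌈n+n/2⌉ m) ⟩
  central (2 + (m + m)) * suc ⌊ suc (m + m) /2⌋  ≡⟨ central-suc (suc (m + m)) ⟩
  (2 + (m + m)) * central (1 + (m + m))          ≡⟨ [2+2m]*c≡2*c*[1+m] m (central (1 + (m + m))) ⟩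
  2 * central (1 + (m + m)) * suc m              ∎)
  where
  open ≡-Reasoning
  [2+2m]*c≡2*c*[1+m] : ∀ m c → (2 + (m + m)) * c ≡ 2 * c * suc m
  [2+2m]*c≡2*c*[1+m] = solve-∀

2*central[1+n]<central[3+n] : ∀ n → 2 * central (suc n) < central (3 + n)
2*central[1+n]<central[3+n] n with even⊎odd n
... | m , inj₁ refl = begin-strict
  2 * central (1 + (m + m))  ≡⟨ central[2+2m]≡2*central[1+2m] m ⟨
  central (2 + (m + m))      <⟨ central-<-suc (suc (m + m)) ⟩
  central (3 + (m + m))      ∎
  where open ≤-Reasoning
... | m , inj₂ refl = begin-strict
  2 * central (2 + (m + m))  <⟨ *-monoʳ-< 2 (central-<-suc (suc (m + m))) ⟩
  2 * central (3 + (m + m))          ≡⟨ cong (λ k → 2 * central (suc k)) [1+m]+[1+m]≡2+2m ⟨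
  2 * central (1 + (suc m + suc m))  ≡⟨ central[2+2m]≡2*central[1+2m] (suc m) ⟨
  central (2 + (suc m + suc m))      ≡⟨ cong (λ k → central (2 + k)) [1+m]+[1+m]≡2+2m ⟩
  central (4 + (m + m))              ∎
  where
  open ≤-Reasoning
  [1+m]+[1+m]≡2+2m : suc m + suc m ≡ 2 + (m + m)
  [1+m]+[1+m]≡2+2m = cong suc (+-suc m m)

-- Moving one element from the larger part to the smaller one never increases a ! * b !.
midChains-minimal : ∀ {n} a b → a + b ≡ n → midChains n ≤ a ! * b !
midChains-minimal {zero} zero zero _ = ≤-refl
midChains-minimal {suc n} a b a+b≡1+n =
  [ (λ b≤a → larger-first a b b≤a a+b≡1+n)
  , (λ a≤b → subst (midChains (suc n) ≤_) (*-comm (b !) (a !))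
                   (larger-first b a a≤b (trans (+-comm b a) a+b≡1+n)))
  ]′ (≤-total b a)
  where
  larger-first : ∀ a b → b ≤ a → a + b ≡ suc n → midChains (suc n) ≤ a ! * b !
  larger-first zero zero _ ()
  larger-first (suc a) b b≤1+a 1+a+b≡1+n = begin
    midChains (suc n)          ≡⟨ midChains-suc n ⟩
    suc ⌊ n /2⌋ * midChains n  ≤⟨ *-mono-≤ (s≤s ⌊n/2⌋≤a) (midChains-minimal a b a+b≡n) ⟩
    suc a * (a ! * b !)        ≡⟨ *-assoc (suc a) (a !) (b !) ⟨
    suc a ! * b !              ∎
    where
    open ≤-Reasoning
    a+b≡n = suc-injective 1+a+b≡1+n
    ⌊n/2⌋≤a : ⌊ n /2⌋ ≤ a
    ⌊n/2⌋≤a = begin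
      ⌊ n /2⌋             ≤⟨ ⌊n/2⌋-mono (subst (_≤ a + suc a) a+b≡n (+-monoʳ-≤ a b≤1+a)) ⟩
      ⌊ a + suc a /2⌋     ≡⟨ cong ⌊_/2⌋ (+-suc a a) ⟩
      ⌈ a + a /2⌉         ≡⟨ n≡⌈n+n/2⌉ a ⟨
      a                   ∎

midChains[2+n]<[1+n]! : ∀ n → 2 ≤ n → midChains (2 + n) < suc n !
midChains[2+n]<[1+n]! n 2≤n = begin-strict
  midChains (2 + n)  ≤⟨ midChains-minimal 2 n refl ⟩
  2 * n !            <⟨ *-monoˡ-< (n !) {{n !≢0}} (s≤s 2≤n) ⟩
  suc n !            ∎
  where open ≤-Reasoning

[1+m]!*[1+n]!≤[m+1+n]! : ∀ m n → suc m ! * suc n ! ≤ (m + suc n) !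
[1+m]!*[1+n]!≤[m+1+n]! zero n = ≤-reflexive (+-identityʳ (suc n !))
[1+m]!*[1+n]!≤[m+1+n]! (suc m) n = begin
  (2 + m) * suc m ! * suc n !      ≡⟨ *-assoc (2 + m) (suc m !) (suc n !) ⟩
  (2 + m) * (suc m ! * suc n !)    ≤⟨ *-mono-≤ (s≤s (m<m+n m (s≤s z≤n))) ([1+m]!*[1+n]!≤[m+1+n]! m n) ⟩
  suc (m + suc n) * (m + suc n) !  ∎
  where open ≤-Reasoning

m!*n≡m*[pred[m]!*n] : ∀ m n → m ≢ 0 → m ! * n ≡ m * (pred m ! * n)
m!*n≡m*[pred[m]!*n] zero n m≢0 = contradiction refl m≢0
m!*n≡m*[pred[m]!*n] (suc m) n _ = *-assoc (suc m) (m !) n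

∑-mono-≤ : ∀ {f g : Fin m → ℕ} → (∀ i → f i ≤ g i) → ∑[ i < m ] f i ≤ ∑[ i < m ] g i
∑-mono-≤ {zero} f≤g = z≤n
∑-mono-≤ {suc m} f≤g = +-mono-≤ (f≤g zero) (∑-mono-≤ (f≤g ∘ suc))

∑-const : ∀ m k → ∑[ i < m ] k ≡ m * k
∑-const zero k = refl
∑-const (suc m) k = cong (k +_) (∑-const m k)

sum-map-zero : ∀ (G : List A) → sum (map (λ _ → 0) G) ≡ 0
sum-map-zero [] = refl
sum-map-zero (_ ∷ G) = sum-map-zero G

∑-sum-map : ∀ (f : Fin m → A → ℕ) G →
            ∑[ i < m ] sum (map (f i) G) ≡ sum (map (λ p → ∑[ i < m ] f i p) G)
∑-sum-map {m} f [] = sum-replicate-zero m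
∑-sum-map f (p ∷ G) = trans (∑-distrib-+ (λ i → f i p) _) (cong (_ +_) (∑-sum-map f G))

sum-map-tabulate : ∀ (f : A → ℕ) (F : Fin N → A) → sum (map f (tabulate F)) ≡ ∑[ i < N ] f (F i)
sum-map-tabulate {N = zero} f F = refl
sum-map-tabulate {N = suc N} f F = cong (f (F zero) +_) (sum-map-tabulate f (F ∘ suc))

pairSum : (A → A → ℕ) → List A → ℕ
pairSum f [] = 0
pairSum f (p ∷ G) = sum (map (f p) G) + pairSum f G

pairSum-congᴬ : ∀ {P : A → Set} {f g : A → A → ℕ} {G} → All P G →
                (∀ {p q} → P p → P q → f p q ≡ g p q) → pairSum f G ≡ pairSum g G
pairSum-congᴬ [] f≡g = refl
pairSum-congᴬ (Pp ∷ PG) f≡g =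
  cong₂ _+_ (cong sum (map-cong-local (All.map (f≡g Pp) PG))) (pairSum-congᴬ PG f≡g)

∑-pairSum : ∀ (f : Fin m → A → A → ℕ) G →
            ∑[ i < m ] pairSum (f i) G ≡ pairSum (λ p q → ∑[ i < m ] f i p q) G
∑-pairSum {m} f [] = sum-replicate-zero m
∑-pairSum f (p ∷ G) = trans (∑-distrib-+ (λ i → sum (map (f i p) G)) _)
  (cong₂ _+_ (∑-sum-map (λ i → f i p) G) (∑-pairSum f G))

∣∷∣-cong : ∀ x {p : Subset m} {q : Subset n} → ∣ p ∣ ≡ ∣ q ∣ → ∣ x ∷ p ∣ ≡ ∣ x ∷ q ∣
∣∷∣-cong inside eq = cong suc eq
∣∷∣-cong outside eq = eq

∣∁⊤∣≡0 : ∀ n → ∣ ∁ (⊤ {n}) ∣ ≡ 0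
∣∁⊤∣≡0 zero = refl
∣∁⊤∣≡0 (suc n) = ∣∁⊤∣≡0 n

⊤─p≡∁p : ∀ (p : Subset n) → ⊤ ─ p ≡ ∁ p
⊤─p≡∁p [] = refl
⊤─p≡∁p (inside ∷ p) = cong (outside ∷_) (⊤─p≡∁p p)
⊤─p≡∁p (outside ∷ p) = cong (inside ∷_) (⊤─p≡∁p p)

∣∁p∣≡0⇒p≡⊤ : ∀ (p : Subset n) → ∣ ∁ p ∣ ≡ 0 → p ≡ ⊤
∣∁p∣≡0⇒p≡⊤ [] _ = refl
∣∁p∣≡0⇒p≡⊤ (inside ∷ p) ∣∁p∣≡0 = cong (inside ∷_) (∣∁p∣≡0⇒p≡⊤ p ∣∁p∣≡0)

∣p∣+∣∁p∣≡n : ∀ (p : Subset n) → ∣ p ∣ + ∣ ∁ p ∣ ≡ n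
∣p∣+∣∁p∣≡n [] = refl
∣p∣+∣∁p∣≡n (inside ∷ p) = cong suc (∣p∣+∣∁p∣≡n p)
∣p∣+∣∁p∣≡n (outside ∷ p) = trans (+-suc ∣ p ∣ ∣ ∁ p ∣) (cong suc (∣p∣+∣∁p∣≡n p))

∣q∣≡∣p∣+∣q─p∣ : ∀ (p q : Subset n) → p ⊆ q → ∣ q ∣ ≡ ∣ p ∣ + ∣ q ─ p ∣
∣q∣≡∣p∣+∣q─p∣ [] [] _ = refl
∣q∣≡∣p∣+∣q─p∣ (inside ∷ p) (inside ∷ q) p⊆q = cong suc (∣q∣≡∣p∣+∣q─p∣ p q (drop-∷-⊆ p⊆q))
∣q∣≡∣p∣+∣q─p∣ (inside ∷ p) (outside ∷ q) p⊆q with () ← p⊆q here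
∣q∣≡∣p∣+∣q─p∣ (outside ∷ p) (inside ∷ q) p⊆q =
  trans (cong suc (∣q∣≡∣p∣+∣q─p∣ p q (drop-∷-⊆ p⊆q))) (sym (+-suc ∣ p ∣ ∣ q ─ p ∣))
∣q∣≡∣p∣+∣q─p∣ (outside ∷ p) (outside ∷ q) p⊆q = ∣q∣≡∣p∣+∣q─p∣ p q (drop-∷-⊆ p⊆q)

∣p∣≡0⇒p⊆q : ∀ (p : Subset n) {q} → ∣ p ∣ ≡ 0 → p ⊆ q
∣p∣≡0⇒p⊆q p ∣p∣≡0 {x} x∈p = ⊥-elim (n≮0 (subst (∣ p - x ∣ <_) ∣p∣≡0 (x∈p⇒∣p-x∣<∣p∣ x∈p)))

∣q─p∣≡0⇒q⊆p : ∀ (p q : Subset n) → ∣ q ─ p ∣ ≡ 0 → q ⊆ p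
∣q─p∣≡0⇒q⊆p p q ∣q─p∣≡0 {x} x∈q with x ∈? p
... | yes x∈p = x∈p
... | no x∉p = ∣p∣≡0⇒p⊆q (q ─ p) ∣q─p∣≡0 (x∈p∧x∉q⇒x∈p─q x∈q x∉p)

zero∈-∷ : ∀ {x} {p : Subset m} {q : Subset n} → zero ∈ x ∷ p → zero ∈ x ∷ q
zero∈-∷ here = here

∣removeAt∣ : ∀ (p : Subset (suc n)) i → lookup p i ≡ outside → ∣ removeAt p i ∣ ≡ ∣ p ∣
∣removeAt∣ (x ∷ p) zero refl = refl
∣removeAt∣ (x ∷ p@(_ ∷ _)) (suc i) pᵢ≡0 = ∣∷∣-cong x {removeAt p i} {p} (∣removeAt∣ p i pᵢ≡0)

∣∁removeAt∣ : ∀ (p : Subset (suc n)) i → lookup p i ≡ outside → suc ∣ ∁ (removeAt p i) ∣ ≡ ∣ ∁ p ∣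
∣∁removeAt∣ (x ∷ p) zero refl = refl
∣∁removeAt∣ (inside ∷ p@(_ ∷ _)) (suc i) pᵢ≡0 = ∣∁removeAt∣ p i pᵢ≡0
∣∁removeAt∣ (outside ∷ p@(_ ∷ _)) (suc i) pᵢ≡0 = cong suc (∣∁removeAt∣ p i pᵢ≡0)

∣removeAt─removeAt∣ : ∀ (p q : Subset (suc n)) i → lookup q i ≡ outside →
                      ∣ removeAt q i ─ removeAt p i ∣ ≡ ∣ q ─ p ∣
∣removeAt─removeAt∣ (inside ∷ p) (y ∷ q) zero refl = refl
∣removeAt─removeAt∣ (outside ∷ p) (y ∷ q) zero refl = refl
∣removeAt─removeAt∣ (inside ∷ p@(_ ∷ _)) (y ∷ q@(_ ∷ _)) (suc i) qᵢ≡0 =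
  ∣removeAt─removeAt∣ p q i qᵢ≡0
∣removeAt─removeAt∣ (outside ∷ p@(_ ∷ _)) (y ∷ q@(_ ∷ _)) (suc i) qᵢ≡0 =
  ∣∷∣-cong y {removeAt q i ─ removeAt p i} {q ─ p} (∣removeAt─removeAt∣ p q i qᵢ≡0)

⊆-outside : ∀ {p q : Subset n} i → p ⊆ q → lookup q i ≡ outside → lookup p i ≡ outside
⊆-outside {p = p} i p⊆q qᵢ≡0 with lookup p i in pᵢ≡1
... | outside = refl
... | inside = contradiction (trans (sym ([]=⇒lookup (p⊆q (lookup⇒[]= i p pᵢ≡1)))) qᵢ≡0) λ ()

removeAt-⊆ : ∀ (p q : Subset (suc n)) i → p ⊆ q → removeAt p i ⊆ removeAt q i
removeAt-⊆ (x ∷ p) (y ∷ q) zero p⊆q = drop-∷-⊆ p⊆q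
removeAt-⊆ (x ∷ p@(_ ∷ _)) (y ∷ q@(_ ∷ _)) (suc i) p⊆q here = zero∈-∷ (p⊆q here)
removeAt-⊆ (x ∷ p@(_ ∷ _)) (y ∷ q@(_ ∷ _)) (suc i) p⊆q (there j∈) =
  there (removeAt-⊆ p q i (drop-∷-⊆ p⊆q) j∈)

removeAt-⊆⁻ : ∀ (p q : Subset (suc n)) i → lookup p i ≡ outside → removeAt p i ⊆ removeAt q i → p ⊆ q
removeAt-⊆⁻ (x ∷ p) (y ∷ q) zero refl p⊆q (there j∈) = there (p⊆q j∈)
removeAt-⊆⁻ (x ∷ p@(_ ∷ _)) (y ∷ q@(_ ∷ _)) (suc i) pᵢ≡0 p⊆q here = zero∈-∷ (p⊆q here)
removeAt-⊆⁻ (x ∷ p@(_ ∷ _)) (y ∷ q@(_ ∷ _)) (suc i) pᵢ≡0 p⊆q (there j∈) =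
  there (removeAt-⊆⁻ p q i pᵢ≡0 (drop-∷-⊆ p⊆q) j∈)

-- Counting maximal chains

-- The numbers of maximal chains ∅ ⊂ {i₁} ⊂ {i₁, i₂} ⊂ ⋯ ⊂ ⊤ passing through p, through p ⊆ q, and
-- through both p and q.
chains : Subset n → ℕ
chains p = ∣ p ∣ ! * ∣ ∁ p ∣ !

nestedChains : Subset n → Subset n → ℕ
nestedChains p q = ∣ p ∣ ! * ∣ q ─ p ∣ ! * ∣ ∁ q ∣ !

commonChains : Subset n → Subset n → ℕ
commonChains p q with p ⊆? q | q ⊆? p
... | yes _ | _     = nestedChains p q
... | no _  | yes _ = nestedChains q p
... | no _  | no _  = 0

module _ {p q : Subset n} where

  commonChains-⊆ : p ⊆ q → commonChains p q ≡ nestedChains p q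
  commonChains-⊆ p⊆q with p ⊆? q | q ⊆? p
  ... | yes _ | _ = refl
  ... | no p⊈q | _ = ⊥-elim (p⊈q p⊆q)

  commonChains-⊇ : p ⊈ q → q ⊆ p → commonChains p q ≡ nestedChains q p
  commonChains-⊇ p⊈q q⊆p with p ⊆? q | q ⊆? p
  ... | yes p⊆q | _ = ⊥-elim (p⊈q p⊆q)
  ... | no _ | yes _ = refl
  ... | no _ | no q⊈p = ⊥-elim (q⊈p q⊆p)

  commonChains-⊈ : p ⊈ q → q ⊈ p → commonChains p q ≡ 0
  commonChains-⊈ p⊈q q⊈p with p ⊆? q | q ⊆? p
  ... | yes p⊆q | _ = ⊥-elim (p⊈q p⊆q)
  ... | no _ | yes q⊆p = ⊥-elim (q⊈p q⊆p)
  ... | no _ | no _ = refl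

  commonChains-comm : commonChains p q ≡ commonChains q p
  commonChains-comm with p ⊆? q | q ⊆? p
  ... | yes p⊆q | yes q⊆p = let p≡q = ⊆-antisym p⊆q q⊆p in cong₂ nestedChains p≡q (sym p≡q)
  ... | yes _ | no _ = refl
  ... | no _ | yes _ = refl
  ... | no _ | no _ = refl

chains-⊤ : chains (⊤ {n}) ≡ n !
chains-⊤ {n} = trans (cong₂ (λ a b → a ! * b !) (∣⊤∣≡n n) (∣∁⊤∣≡0 n)) (*-identityʳ (n !))

nestedChains-⊤ : ∀ (p : Subset n) → nestedChains p ⊤ ≡ chains p
nestedChains-⊤ {n} p =
  trans (cong₂ (λ a b → ∣ p ∣ ! * a ! * b !) (cong ∣_∣ (⊤─p≡∁p p)) (∣∁⊤∣≡0 n)) (*-identityʳ (chains p))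

commonChains-⊤ʳ : ∀ (p : Subset n) → commonChains p ⊤ ≡ chains p
commonChains-⊤ʳ p = trans (commonChains-⊆ {p = p} ⊆⊤) (nestedChains-⊤ p)

commonChains-⊤ˡ : ∀ (p : Subset n) → commonChains ⊤ p ≡ chains p
commonChains-⊤ˡ p = trans (commonChains-comm {p = ⊤} {q = p}) (commonChains-⊤ʳ p)

∑-outside-const : ∀ (p : Subset n) k → ∑[ i < n ] (if lookup p i then 0 else k) ≡ ∣ ∁ p ∣ * k
∑-outside-const [] k = refl
∑-outside-const (inside ∷ p) k = ∑-outside-const p k
∑-outside-const (outside ∷ p) k = cong (k +_) (∑-outside-const p k)

if-outside-cong : ∀ b {x y : ℕ} → (b ≡ outside → x ≡ y) → (if b then 0 else x) ≡ (if b then 0 else y)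
if-outside-cong true _ = refl
if-outside-cong false x≡y = x≡y refl

-- Classify the maximal chains through p by the element added last, which lies outside p.
chains-removeAt : ∀ (p : Subset (suc n)) {k} → ∣ ∁ p ∣ ≡ suc k →
                  ∑[ i < suc n ] (if lookup p i then 0 else chains (removeAt p i)) ≡ chains p
chains-removeAt {n} p {k} ∣∁p∣≡1+k = begin
  ∑[ i < suc n ] (if lookup p i then 0 else chains (removeAt p i))
    ≡⟨ sum-cong-≗ (λ i → if-outside-cong (lookup p i) (removed i)) ⟩
  ∑[ i < suc n ] (if lookup p i then 0 else ∣ p ∣ ! * k !)
    ≡⟨ ∑-outside-const p (∣ p ∣ ! * k !) ⟩
  ∣ ∁ p ∣ * (∣ p ∣ ! * k !)  ≡⟨ cong (_* (∣ p ∣ ! * k !)) ∣∁p∣≡1+k ⟩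
  suc k * (∣ p ∣ ! * k !)    ≡⟨ x∙yz≈y∙xz (suc k) (∣ p ∣ !) (k !) ⟩
  ∣ p ∣ ! * suc k !          ≡⟨ cong (λ m → ∣ p ∣ ! * m !) ∣∁p∣≡1+k ⟨
  chains p                   ∎
  where
  open ≡-Reasoning
  removed : ∀ i → lookup p i ≡ outside → chains (removeAt p i) ≡ ∣ p ∣ ! * k !
  removed i pᵢ≡0 = cong₂ (λ a b → a ! * b !) (∣removeAt∣ p i pᵢ≡0)
                         (suc-injective (trans (∣∁removeAt∣ p i pᵢ≡0) ∣∁p∣≡1+k))

nestedChains-removeAt : ∀ {p q : Subset (suc n)} {k} → p ⊆ q → ∣ ∁ q ∣ ≡ suc k →
  ∑[ i < suc n ] (if lookup q i then 0 else nestedChains (removeAt p i) (removeAt q i)) ≡ nestedChains p q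
nestedChains-removeAt {n} {p} {q} {k} p⊆q ∣∁q∣≡1+k = begin
  ∑[ i < suc n ] (if lookup q i then 0 else nestedChains (removeAt p i) (removeAt q i))
    ≡⟨ sum-cong-≗ (λ i → if-outside-cong (lookup q i) (removed i)) ⟩
  ∑[ i < suc n ] (if lookup q i then 0 else c * k !)
    ≡⟨ ∑-outside-const q (c * k !) ⟩
  ∣ ∁ q ∣ * (c * k !)  ≡⟨ cong (_* (c * k !)) ∣∁q∣≡1+k ⟩
  suc k * (c * k !)    ≡⟨ x∙yz≈y∙xz (suc k) c (k !) ⟩
  c * suc k !          ≡⟨ cong (λ m → c * m !) ∣∁q∣≡1+k ⟨
  nestedChains p q     ∎
  where
  open ≡-Reasoning
  c = ∣ p ∣ ! * ∣ q ─ p ∣ !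
  removed : ∀ i → lookup q i ≡ outside → nestedChains (removeAt p i) (removeAt q i) ≡ c * k !
  removed i qᵢ≡0 = cong₃ (λ a b d → a ! * b ! * d !)
    (∣removeAt∣ p i (⊆-outside i p⊆q qᵢ≡0))
    (∣removeAt─removeAt∣ p q i qᵢ≡0)
    (suc-injective (trans (∣∁removeAt∣ q i qᵢ≡0) ∣∁q∣≡1+k))
    where
    cong₃ : ∀ {a b d a′ b′ d′ : ℕ} (f : ℕ → ℕ → ℕ → ℕ) →
            a ≡ a′ → b ≡ b′ → d ≡ d′ → f a b d ≡ f a′ b′ d′
    cong₃ f refl refl refl = refl

commonChains-removeAt-⊆ : ∀ (p q : Subset (suc n)) → p ⊆ q → ∀ i →
  (if lookup p i then 0 else if lookup q i then 0 else commonChains (removeAt p i) (removeAt q i))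
  ≡ (if lookup q i then 0 else nestedChains (removeAt p i) (removeAt q i))
commonChains-removeAt-⊆ p q p⊆q i with lookup p i in pᵢ | lookup q i in qᵢ
... | true  | true  = refl
... | true  | false = contradiction (trans (sym pᵢ) (⊆-outside i p⊆q qᵢ)) λ ()
... | false | true  = refl
... | false | false = commonChains-⊆ (removeAt-⊆ p q i p⊆q)

commonChains-removeAt : ∀ (p q : Subset (suc n)) {k l} → ∣ ∁ p ∣ ≡ suc k → ∣ ∁ q ∣ ≡ suc l →
  ∑[ i < suc n ] (if lookup p i then 0 else if lookup q i then 0 else commonChains (removeAt p i) (removeAt q i))
  ≡ commonChains p q
commonChains-removeAt {n} p q ∣∁p∣≡1+k ∣∁q∣≡1+l with p ⊆? q | q ⊆? p
... | yes p⊆q | _ =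
  trans (sum-cong-≗ (commonChains-removeAt-⊆ p q p⊆q)) (nestedChains-removeAt p⊆q ∣∁q∣≡1+l)
... | no p⊈q | yes q⊆p =
  trans (sum-cong-≗ (λ i → trans (swap i) (commonChains-removeAt-⊆ q p q⊆p i)))
        (nestedChains-removeAt q⊆p ∣∁p∣≡1+k)
  where
  swap : ∀ i → (if lookup p i then 0 else if lookup q i then 0 else commonChains (removeAt p i) (removeAt q i))
             ≡ (if lookup q i then 0 else if lookup p i then 0 else commonChains (removeAt q i) (removeAt p i))
  swap i with lookup p i | lookup q i
  ... | true  | true  = refl
  ... | true  | false = refl
  ... | false | true  = refl
  ... | false | false = commonChains-comm {p = removeAt p i}
... | no p⊈q | no q⊈p = trans (sum-cong-≗ vanishes) (sum-replicate-zero (suc n))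
  where
  vanishes : ∀ i →
    (if lookup p i then 0 else if lookup q i then 0 else commonChains (removeAt p i) (removeAt q i)) ≡ 0
  vanishes i with lookup p i in pᵢ | lookup q i in qᵢ
  ... | true  | _     = refl
  ... | false | true  = refl
  ... | false | false = commonChains-⊈ (p⊈q ∘ removeAt-⊆⁻ p q i pᵢ) (q⊈p ∘ removeAt-⊆⁻ q p i qᵢ)

chainSum : List (Subset n) → ℕ
chainSum G = sum (map chains G)

pairChainSum : List (Subset n) → ℕ
pairChainSum = pairSum commonChains

restrictAt : Fin (suc n) → List (Subset (suc n)) → List (Subset n)
restrictAt i [] = []
restrictAt i (p ∷ G) = if lookup p i then restrictAt i G else removeAt p i ∷ restrictAt i G

sum-map-restrictAt : ∀ (f : Subset n → ℕ) i G →
  sum (map f (restrictAt i G)) ≡ sum (map (λ p → if lookup p i then 0 else f (removeAt p i)) G)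
sum-map-restrictAt f i [] = refl
sum-map-restrictAt f i (p ∷ G) with lookup p i
... | true  = sum-map-restrictAt f i G
... | false = cong (f (removeAt p i) +_) (sum-map-restrictAt f i G)

pairSum-restrictAt : ∀ (f : Subset n → Subset n → ℕ) i G →
  pairSum f (restrictAt i G)
  ≡ pairSum (λ p q → if lookup p i then 0 else if lookup q i then 0 else f (removeAt p i) (removeAt q i)) G
pairSum-restrictAt f i [] = refl
pairSum-restrictAt f i (p ∷ G) with lookup p i
... | true  = trans (pairSum-restrictAt f i G) (cong (_+ pairSum _ G) (sym (sum-map-zero G)))
... | false = cong₂ _+_ (sum-map-restrictAt (f (removeAt p i)) i G) (pairSum-restrictAt f i G)

Proper : Subset n → Set
Proper p = ∃[ k ] ∣ ∁ p ∣ ≡ suc k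

chainSum-restrictAt : ∀ {G : List (Subset (suc n))} → All Proper G →
                      ∑[ i < suc n ] chainSum (restrictAt i G) ≡ chainSum G
chainSum-restrictAt {n} {G} proper = begin
  ∑[ i < suc n ] chainSum (restrictAt i G)
    ≡⟨ sum-cong-≗ (λ i → sum-map-restrictAt chains i G) ⟩
  ∑[ i < suc n ] sum (map (λ p → if lookup p i then 0 else chains (removeAt p i)) G)
    ≡⟨ ∑-sum-map (λ i p → if lookup p i then 0 else chains (removeAt p i)) G ⟩
  sum (map (λ p → ∑[ i < suc n ] (if lookup p i then 0 else chains (removeAt p i))) G)
    ≡⟨ cong sum (map-cong-local (All.map (λ { {p} (_ , ∣∁p∣≡1+k) → chains-removeAt p ∣∁p∣≡1+k }) proper)) ⟩
  chainSum G ∎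
  where open ≡-Reasoning

pairChainSum-restrictAt : ∀ {G : List (Subset (suc n))} → All Proper G →
                          ∑[ i < suc n ] pairChainSum (restrictAt i G) ≡ pairChainSum G
pairChainSum-restrictAt {n} {G} proper = begin
  ∑[ i < suc n ] pairChainSum (restrictAt i G)
    ≡⟨ sum-cong-≗ (λ i → pairSum-restrictAt commonChains i G) ⟩
  ∑[ i < suc n ] pairSum (restricted i) G
    ≡⟨ ∑-pairSum restricted G ⟩
  pairSum (λ p q → ∑[ i < suc n ] restricted i p q) G
    ≡⟨ pairSum-congᴬ proper (λ { {p} {q} (_ , ∣∁p∣≡1+k) (_ , ∣∁q∣≡1+l) →
                                   commonChains-removeAt p q ∣∁p∣≡1+k ∣∁q∣≡1+l }) ⟩
  pairChainSum G ∎
  where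
  open ≡-Reasoning
  restricted : Fin (suc n) → Subset (suc n) → Subset (suc n) → ℕ
  restricted i p q = if lookup p i then 0 else if lookup q i then 0 else commonChains (removeAt p i) (removeAt q i)

full-or-proper : ∀ (G : List (Subset n)) → Any (_≡ ⊤) G ⊎ All Proper G
full-or-proper [] = inj₂ []
full-or-proper (p ∷ G) with ∣ ∁ p ∣ in ∣∁p∣≡ | full-or-proper G
... | zero  | _           = inj₁ (here (∣∁p∣≡0⇒p≡⊤ p ∣∁p∣≡))
... | suc _ | inj₁ ⊤∈G    = inj₁ (there ⊤∈G)
... | suc k | inj₂ proper = inj₂ ((k , ∣∁p∣≡) ∷ proper)

chains≤sum-commonChains : ∀ (p : Subset n) {G} → Any (_≡ ⊤) G → chains p ≤ sum (map (commonChains p) G)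
chains≤sum-commonChains p {q ∷ G} (here refl) = ≤-trans (≤-reflexive (sym (commonChains-⊤ʳ p))) (m≤m+n _ _)
chains≤sum-commonChains p {q ∷ G} (there ⊤∈G) = ≤-trans (chains≤sum-commonChains p ⊤∈G) (m≤n+m _ _)

-- Every maximal chain passes through ⊤.
bonferroni-⊤ : ∀ {G : List (Subset n)} → Any (_≡ ⊤) G → chainSum G ≤ n ! + pairChainSum G
bonferroni-⊤ {n} {p ∷ G} (here refl) = begin
  chains (⊤ {n}) + chainSum G
    ≡⟨ cong₂ _+_ (chains-⊤ {n}) (cong sum (map-cong (sym ∘ commonChains-⊤ˡ) G)) ⟩
  n ! + sum (map (commonChains ⊤) G)
    ≤⟨ +-monoʳ-≤ (n !) (m≤m+n _ (pairChainSum G)) ⟩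
  n ! + pairChainSum (⊤ ∷ G)
    ∎
  where open ≤-Reasoning
bonferroni-⊤ {n} {p ∷ G} (there ⊤∈G) = begin
  chains p + chainSum G
    ≤⟨ +-mono-≤ (chains≤sum-commonChains p ⊤∈G) (bonferroni-⊤ ⊤∈G) ⟩
  sum (map (commonChains p) G) + (n ! + pairChainSum G)
    ≡⟨ m+[n+o]≡n+[m+o] _ (n !) (pairChainSum G) ⟩
  n ! + pairChainSum (p ∷ G)
    ∎
  where open ≤-Reasoning

bonferroni : ∀ (G : List (Subset n)) → chainSum G ≤ n ! + pairChainSum G
bonferroni G with full-or-proper G
... | inj₁ ⊤∈G = bonferroni-⊤ ⊤∈G
bonferroni {zero} [] | inj₂ _ = z≤n
bonferroni {zero} ([] ∷ G) | inj₂ ((_ , ()) ∷ _)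
bonferroni {suc n} G | inj₂ proper = begin
  chainSum G                                              ≡⟨ chainSum-restrictAt proper ⟨
  ∑[ i < suc n ] chainSum (restrictAt i G)                ≤⟨ ∑-mono-≤ (λ i → bonferroni (restrictAt i G)) ⟩
  ∑[ i < suc n ] (n ! + pairChainSum (restrictAt i G))
    ≡⟨ ∑-distrib-+ (λ _ → n !) (λ i → pairChainSum (restrictAt i G)) ⟩
  ∑[ i < suc n ] (n !) + ∑[ i < suc n ] pairChainSum (restrictAt i G)
    ≡⟨ cong₂ _+_ (∑-const (suc n) (n !)) (pairChainSum-restrictAt proper) ⟩
  suc n ! + pairChainSum G                                ∎
  where open ≤-Reasoning

-- Sperner's theorem

IsAntichain : (Fin N → Subset n) → Set
IsAntichain {N} F = ∀ (i j : Fin N) → i ≢ j → F i ⊈ F j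

pairChainSum-antichain : ∀ {F : Fin N → Subset n} → IsAntichain F → pairChainSum (tabulate F) ≡ 0
pairChainSum-antichain {zero} _ = refl
pairChainSum-antichain {suc N} {F = F} ac = cong₂ _+_
  (trans (sum-map-tabulate (commonChains (F zero)) (F ∘ suc))
         (trans (sum-cong-≗ (λ j → commonChains-⊈ {p = F zero} (ac zero (suc j) λ ()) (ac (suc j) zero λ ())))
                (sum-replicate-zero N)))
  (pairChainSum-antichain λ i j i≢j → ac (suc i) (suc j) (i≢j ∘ Finₚ.suc-injective))

lubell : ∀ {F : Fin N → Subset n} → IsAntichain F → ∑[ i < N ] chains (F i) ≤ n !
lubell {N} {n} {F} ac = begin
  ∑[ i < N ] chains (F i)                 ≡⟨ sum-map-tabulate chains F ⟨
  chainSum (tabulate F)                   ≤⟨ bonferroni (tabulate F) ⟩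
  n ! + pairChainSum (tabulate F)         ≡⟨ cong (n ! +_) (pairChainSum-antichain ac) ⟩
  n ! + 0                                 ≡⟨ +-identityʳ (n !) ⟩
  n !                                     ∎
  where open ≤-Reasoning

midChains≤chains : ∀ (p : Subset n) → midChains n ≤ chains p
midChains≤chains p = midChains-minimal ∣ p ∣ ∣ ∁ p ∣ (∣p∣+∣∁p∣≡n p)

N*midChains≤∑chains : ∀ (F : Fin N → Subset n) → N * midChains n ≤ ∑[ i < N ] chains (F i)
N*midChains≤∑chains {N} {n} F = begin
  N * midChains n                ≡⟨ ∑-const N (midChains n) ⟨
  ∑[ i < N ] midChains n         ≤⟨ ∑-mono-≤ (midChains≤chains ∘ F) ⟩
  ∑[ i < N ] chains (F i)        ∎
  where open ≤-Reasoning

sperner : ∀ {F : Fin N → Subset n} → IsAntichain F → N ≤ central n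
sperner {N} {n} {F} ac = *-cancelʳ-≤ N (central n) (midChains n) {{midChains≢0 n}} (begin
  N * midChains n            ≤⟨ N*midChains≤∑chains F ⟩
  ∑[ i < N ] chains (F i)    ≤⟨ lubell ac ⟩
  n !                        ≡⟨ central*midChains≡n! n ⟨
  central n * midChains n    ∎)
  where open ≤-Reasoning

nestedChains≤ : ∀ (p q : Subset n) → p ⊆ q → ∣ p ∣ ≢ 0 → ∣ q ─ p ∣ ≢ 0 →
                nestedChains p q ≤ pred ∣ q ∣ ! * ∣ ∁ q ∣ !
nestedChains≤ p q p⊆q ∣p∣≢0 ∣q─p∣≢0 =
  *-monoˡ-≤ (∣ ∁ q ∣ !) (bound ∣ p ∣ ∣ q ─ p ∣ ∣p∣≢0 ∣q─p∣≢0 (∣q∣≡∣p∣+∣q─p∣ p q p⊆q))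
  where
  bound : ∀ a b → a ≢ 0 → b ≢ 0 → ∣ q ∣ ≡ a + b → a ! * b ! ≤ pred ∣ q ∣ !
  bound zero _ a≢0 _ _ = contradiction refl a≢0
  bound (suc a) zero _ b≢0 _ = contradiction refl b≢0
  bound (suc a) (suc b) _ _ ∣q∣≡a+b rewrite ∣q∣≡a+b = [1+m]!*[1+n]!≤[m+1+n]! a b

module _ {p q : Subset n} (p⊈q : p ⊈ q) (q⊈p : q ⊈ p) where

  private
    U = p ∪ q
    B = pred ∣ U ∣ ! * ∣ ∁ U ∣ !

    ∣p∣≢0 : ∣ p ∣ ≢ 0
    ∣p∣≢0 = p⊈q ∘ ∣p∣≡0⇒p⊆q p

    ∣q∣≢0 : ∣ q ∣ ≢ 0
    ∣q∣≢0 = q⊈p ∘ ∣p∣≡0⇒p⊆q q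

    ∣U─p∣≢0 : ∣ U ─ p ∣ ≢ 0
    ∣U─p∣≢0 = q⊈p ∘ ⊆-trans (q⊆p∪q p q) ∘ ∣q─p∣≡0⇒q⊆p p U

    ∣U─q∣≢0 : ∣ U ─ q ∣ ≢ 0
    ∣U─q∣≢0 = p⊈q ∘ ⊆-trans (p⊆p∪q q) ∘ ∣q─p∣≡0⇒q⊆p q U

    nestedChains-∪≤2B : nestedChains p U + nestedChains q U ≤ 2 * B
    nestedChains-∪≤2B = +-mono-≤ (nestedChains≤ p U (p⊆p∪q q) ∣p∣≢0 ∣U─p∣≢0)
      (≤-trans (nestedChains≤ q U (q⊆p∪q p q) ∣q∣≢0 ∣U─q∣≢0) (≤-reflexive (sym (+-identityʳ B))))

    ∣p∣<∣U∣ : ∣ p ∣ < ∣ U ∣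
    ∣p∣<∣U∣ = subst (∣ p ∣ <_) (sym (∣q∣≡∣p∣+∣q─p∣ p U (p⊆p∪q q))) (m<m+n ∣ p ∣ (n≢0⇒n>0 ∣U─p∣≢0))

    chains-U : chains U ≡ ∣ U ∣ * B
    chains-U = m!*n≡m*[pred[m]!*n] ∣ U ∣ (∣ ∁ U ∣ !) (λ ∣U∣≡0 → n≮0 (subst (∣ p ∣ <_) ∣U∣≡0 ∣p∣<∣U∣))

  nestedChains-∪≤chains : nestedChains p (p ∪ q) + nestedChains q (p ∪ q) ≤ chains (p ∪ q)
  nestedChains-∪≤chains = ≤-trans nestedChains-∪≤2B
    (subst (2 * B ≤_) (sym chains-U) (*-monoˡ-≤ B (≤-trans (s≤s (n≢0⇒n>0 ∣p∣≢0)) ∣p∣<∣U∣)))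

  nestedChains-∪<chains : 2 ≤ ∣ p ∣ → nestedChains p (p ∪ q) + nestedChains q (p ∪ q) < chains (p ∪ q)
  nestedChains-∪<chains 2≤∣p∣ = ≤-<-trans nestedChains-∪≤2B
    (subst (2 * B <_) (sym chains-U)
           (*-monoˡ-< B {{pred ∣ U ∣ !* ∣ ∁ U ∣ !≢0}} (≤-trans (s≤s 2≤∣p∣) ∣p∣<∣U∣)))

midChains<chains : ∀ (p : Subset n) → 4 ≤ n → ∣ p ∣ ≡ 1 → midChains n < chains p
midChains<chains {suc (suc k)} p (s≤s (s≤s 2≤k)) ∣p∣≡1 = begin-strict
  midChains (2 + k)    <⟨ midChains[2+n]<[1+n]! k 2≤k ⟩
  suc k !              ≡⟨ cong _! ∣∁p∣≡1+k ⟨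
  ∣ ∁ p ∣ !            ≡⟨ +-identityʳ (∣ ∁ p ∣ !) ⟨
  1 ! * ∣ ∁ p ∣ !      ≡⟨ cong (λ a → a ! * ∣ ∁ p ∣ !) ∣p∣≡1 ⟨
  chains p             ∎
  where
  open ≤-Reasoning
  ∣∁p∣≡1+k : ∣ ∁ p ∣ ≡ suc k
  ∣∁p∣≡1+k = suc-injective (trans (cong (_+ ∣ ∁ p ∣) (sym ∣p∣≡1)) (∣p∣+∣∁p∣≡n p))

module _ {F : Fin (2 + N) → Subset n} (ac : IsAntichain F)
         (sep : ∀ w → F (suc (suc w)) ⊈ F zero ∪ F (suc zero)) where

  private
    p = F zero
    q = F (suc zero)
    U = p ∪ q
    p⊈q = ac zero (suc zero) λ ()
    q⊈p = ac (suc zero) zero λ ()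

    p⊆U : p ⊆ U
    p⊆U = p⊆p∪q {p = p} q

    q⊆U : q ⊆ U
    q⊆U = q⊆p∪q p q

    U⊈p : U ⊈ p
    U⊈p = q⊈p ∘ ⊆-trans q⊆U

    U⊈q : U ⊈ q
    U⊈q = p⊈q ∘ ⊆-trans p⊆U

    pairChainSum-U : pairChainSum (U ∷ tabulate F) ≡ nestedChains p U + nestedChains q U
    pairChainSum-U = begin
      (commonChains U p + (commonChains U q + sum (map (commonChains U) (tabulate (λ w → F (suc (suc w)))))))
        + pairChainSum (tabulate F)
        ≡⟨ cong₂ _+_ (cong₂ _+_ (commonChains-⊇ {p = U} U⊈p p⊆U)
                                (cong₂ _+_ (commonChains-⊇ {p = U} U⊈q q⊆U) rest≡0))
                     (pairChainSum-antichain ac) ⟩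
      (nestedChains p U + (nestedChains q U + 0)) + 0
        ≡⟨ trans (+-identityʳ _) (cong (nestedChains p U +_) (+-identityʳ (nestedChains q U))) ⟩
      nestedChains p U + nestedChains q U ∎
      where
      open ≡-Reasoning
      rest≡0 : sum (map (commonChains U) (tabulate (λ w → F (suc (suc w))))) ≡ 0
      rest≡0 = trans (sum-map-tabulate (commonChains U) (λ w → F (suc (suc w))))
        (trans (sum-cong-≗ (λ w → commonChains-⊈ {p = U} (ac zero (suc (suc w)) (λ ()) ∘ ⊆-trans p⊆U) (sep w)))
               (sum-replicate-zero N))

  bonferroni-∪ : chains U + ∑[ i < 2 + N ] chains (F i) ≤ n ! + (nestedChains p U + nestedChains q U)
  bonferroni-∪ = begin
    chains U + ∑[ i < 2 + N ] chains (F i)   ≡⟨ cong (chains U +_) (sum-map-tabulate chains F) ⟨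
    chainSum (U ∷ tabulate F)                ≤⟨ bonferroni (U ∷ tabulate F) ⟩
    n ! + pairChainSum (U ∷ tabulate F)      ≡⟨ cong (n ! +_) pairChainSum-U ⟩
    n ! + (nestedChains p U + nestedChains q U) ∎
    where open ≤-Reasoning

  sperner-strict : 4 ≤ n → 2 + N < central n
  sperner-strict 4≤n = *-cancelʳ-< (midChains n) (2 + N) (central n)
    (subst ((2 + N) * midChains n <_) (sym (central*midChains≡n! n)) count<n!)
    where
    S = ∑[ i < 2 + N ] chains (F i)

    S≤n! : S ≤ n !
    S≤n! = +-cancelˡ-≤ (chains U) S (n !) (begin
      chains U + S                                 ≤⟨ bonferroni-∪ ⟩
      n ! + (nestedChains p U + nestedChains q U)  ≤⟨ +-monoʳ-≤ (n !) (nestedChains-∪≤chains p⊈q q⊈p) ⟩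
      n ! + chains U                               ≡⟨ +-comm (n !) (chains U) ⟩
      chains U + n !                               ∎)
      where open ≤-Reasoning

    S<n! : 2 ≤ ∣ p ∣ → S < n !
    S<n! 2≤∣p∣ = +-cancelˡ-< (chains U) S (n !) (begin-strict
      chains U + S                                 ≤⟨ bonferroni-∪ ⟩
      n ! + (nestedChains p U + nestedChains q U)  <⟨ +-monoʳ-< (n !) (nestedChains-∪<chains p⊈q q⊈p 2≤∣p∣) ⟩
      n ! + chains U                               ≡⟨ +-comm (n !) (chains U) ⟩
      chains U + n !                               ∎)
      where open ≤-Reasoning

    -- Either |F 0| = 1, and F 0 lies on more than midChains n maximal chains, or the extra set
    -- F 0 ∪ F 1 has at least 3 elements, and the Bonferroni bound is strict.
    count<n! : (2 + N) * midChains n < n !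
    count<n! with ∣ p ∣ in ∣p∣≡
    ... | zero = ⊥-elim (p⊈q (∣p∣≡0⇒p⊆q p ∣p∣≡))
    ... | suc zero = <-≤-trans
      (+-mono-<-≤ (midChains<chains p 4≤n ∣p∣≡) (N*midChains≤∑chains (λ i → F (suc i)))) S≤n!
    ... | suc (suc _) = ≤-<-trans (N*midChains≤∑chains F) (S<n! (subst (2 ≤_) (sym ∣p∣≡) (s≤s (s≤s z≤n))))

layer : (n k : ℕ) → List (Subset n)
layer zero    zero    = [] ∷ []
layer zero    (suc k) = []
layer (suc n) zero    = map (outside ∷_) (layer n zero)
layer (suc n) (suc k) = map (outside ∷_) (layer n (suc k)) ++ map (inside ∷_) (layer n k)

length-layer : ∀ n k → length (layer n k) ≡ n C k
length-layer zero    zero    = refl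
length-layer zero    (suc k) = refl
length-layer (suc n) zero    = trans (length-map (outside ∷_) (layer n zero)) (length-layer n zero)
length-layer (suc n) (suc k) = begin
  length (map (outside ∷_) (layer n (suc k)) ++ map (inside ∷_) (layer n k))
    ≡⟨ length-++ (map (outside ∷_) (layer n (suc k))) ⟩
  length (map (outside ∷_) (layer n (suc k))) + length (map (inside ∷_) (layer n k))
    ≡⟨ cong₂ _+_ (trans (length-map _ (layer n (suc k))) (length-layer n (suc k)))
                 (trans (length-map _ (layer n k)) (length-layer n k)) ⟩
  n C suc k + n C k   ≡⟨ +-comm (n C suc k) (n C k) ⟩
  n C k + n C suc k   ≡⟨ nCk+nC[k+1]≡[n+1]C[k+1] n k ⟩
  suc n C suc k       ∎
  where open ≡-Reasoning

∣layer∣ : ∀ n k → All (λ p → ∣ p ∣ ≡ k) (layer n k)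
∣layer∣ zero    zero    = refl ∷ []
∣layer∣ zero    (suc k) = []
∣layer∣ (suc n) zero    = All.map⁺ (∣layer∣ n zero)
∣layer∣ (suc n) (suc k) =
  All.++⁺ (All.map⁺ (∣layer∣ n (suc k))) (All.map⁺ (All.map (cong suc) (∣layer∣ n k)))

Incomparable : ∀ {n} → Subset n → Subset n → Set
Incomparable p q = p ⊈ q × q ⊈ p

incomparable-∷ : ∀ {n x} {p q : Subset n} → Incomparable p q → Incomparable (x ∷ p) (x ∷ q)
incomparable-∷ (p⊈q , q⊈p) = p⊈q ∘ drop-∷-⊆ , q⊈p ∘ drop-∷-⊆

-- Across the two halves of layer (suc n) (suc k): a tail of size suc k is not inside one of size
-- k, and only the second half contains coordinate 0.
layer-incomparable : ∀ n k → AllPairs Incomparable (layer n k)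
layer-incomparable zero    zero    = [] ∷ []
layer-incomparable zero    (suc k) = []
layer-incomparable (suc n) zero    = AllPairs.map⁺ (AllPairs.map incomparable-∷ (layer-incomparable n zero))
layer-incomparable (suc n) (suc k) = AllPairs.++⁺
  (AllPairs.map⁺ (AllPairs.map incomparable-∷ (layer-incomparable n (suc k))))
  (AllPairs.map⁺ (AllPairs.map incomparable-∷ (layer-incomparable n k)))
  (All.map⁺ (All.map (λ ∣p∣≡1+k → All.map⁺ (All.map (λ ∣q∣≡k → separated ∣p∣≡1+k ∣q∣≡k) (∣layer∣ n k)))
                     (∣layer∣ n (suc k))))
  where
  separated : ∀ {p q : Subset n} → ∣ p ∣ ≡ suc k → ∣ q ∣ ≡ k → Incomparable (outside ∷ p) (inside ∷ q)
  separated {p} {q} ∣p∣≡1+k ∣q∣≡k =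
    (λ p⊆q → <-irrefl refl (subst₂ _≤_ ∣p∣≡1+k ∣q∣≡k (p⊆q⇒∣p∣≤∣q∣ (drop-∷-⊆ p⊆q))))
    , λ q⊆p → case q⊆p here of λ ()

allPairs-lookup : ∀ {a r} {A : Set a} {R : Rel A r} → Symmetric R → ∀ {xs} → AllPairs R xs →
                  ∀ {i j} → i ≢ j → R (List.lookup xs i) (List.lookup xs j)
allPairs-lookup R-sym (_ ∷ _) {zero} {zero} i≢j = contradiction refl i≢j
allPairs-lookup R-sym (Rx ∷ _) {zero} {suc j} _ = All.lookup Rx (∈-lookup j)
allPairs-lookup R-sym (Rx ∷ _) {suc i} {zero} _ = R-sym (All.lookup Rx (∈-lookup i))
allPairs-lookup R-sym (_ ∷ Rxs) {suc i} {suc j} i≢j = allPairs-lookup R-sym Rxs (i≢j ∘ cong suc)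

antichain-of-size : ∀ {M n} → M ≤ central n → Σ[ F ∈ (Fin M → Subset n) ] IsAntichain F
antichain-of-size {M} {n} M≤central = F , λ i j i≢j →
  proj₁ (allPairs-lookup (λ (p⊈q , q⊈p) → q⊈p , p⊈q) (layer-incomparable n ⌊ n /2⌋)
                         (i≢j ∘ inject≤-injective M≤length M≤length i j))
  where
  M≤length = subst (M ≤_) (sym (length-layer n ⌊ n /2⌋)) M≤central
  F = λ i → List.lookup (layer n ⌊ n /2⌋) (inject≤ i M≤length)

-- Cover-free families

module _ {N t : ℕ} {G : Graph N} {B : Family N t} where

  ECFF-⊈ : IsECFF G B → ∀ {j k w} → Adj G j k → w ≢ j → w ≢ k → B w ⊈ B j
  ECFF-⊈ ecff {j} {k} {w} adj w≢j w≢k Bw⊆Bj = ecff j k w adj w≢j w≢k (⊆-trans Bw⊆Bj (p⊆p∪q (B k)))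

  CFF-antichain : IsCFF G B → (∀ j → ∃ (Adj G j)) → IsAntichain B
  CFF-antichain (ecff , separated) neighbour w j w≢j with neighbour j
  ... | k , adj with w Finₚ.≟ k
  ...   | yes refl = proj₂ (separated j w adj)
  ...   | no w≢k = ECFF-⊈ ecff adj w≢j w≢k

++-⊆ˡ : ∀ {m n} (u v : Subset m) {p q : Subset n} → u ++ᵛ p ⊆ v ++ᵛ q → u ⊆ v
++-⊆ˡ (_ ∷ u) (_ ∷ v) up⊆vq here = zero∈-∷ (up⊆vq here)
++-⊆ˡ (_ ∷ u) (_ ∷ v) up⊆vq (there x∈u) = there (++-⊆ˡ u v (drop-∷-⊆ up⊆vq) x∈u)

++-⊆ʳ : ∀ {m n} (u v : Subset m) {p q : Subset n} → u ++ᵛ p ⊆ v ++ᵛ q → p ⊆ q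
++-⊆ʳ [] [] p⊆q = p⊆q
++-⊆ʳ (_ ∷ u) (_ ∷ v) up⊆vq = ++-⊆ʳ u v (drop-∷-⊆ up⊆vq)

module _ {N t : ℕ} {G : Graph N} (colour : Fin N → Fin 2)
         (proper : ∀ {a b} → Adj G a b → colour a ≢ colour b) where

  tagged : Family N t → Family N (2 + t)
  tagged B v = ⁅ colour v ⁆ ++ᵛ B v

  tagged-CFF : ∀ {B : Family N t} → IsECFF G B → IsCFF G (tagged B)
  tagged-CFF {B} ecff = tagged-ECFF , separated
    where
    tagged-ECFF : IsECFF G (tagged B)
    tagged-ECFF a b w adj w≢a w≢b Bw⊆ = ecff a b w adj w≢a w≢b
      (++-⊆ʳ ⁅ colour w ⁆ (⁅ colour a ⁆ ∪ ⁅ colour b ⁆)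
        (subst (tagged B w ⊆_) (zipWith-++ _∨_ ⁅ colour a ⁆ (B a) ⁅ colour b ⁆ (B b)) Bw⊆))
    ⁅⁆-injective : ∀ {a b} → ⁅ colour a ⁆ ⊆ ⁅ colour b ⁆ → colour a ≡ colour b
    ⁅⁆-injective {a} ⊆ = x∈⁅y⁆⇒x≡y _ (⊆ (x∈⁅x⁆ (colour a)))
    separated : ∀ a b → Adj G a b → ¬ (tagged B a ⊆ tagged B b) × ¬ (tagged B b ⊆ tagged B a)
    separated a b adj =
        (λ Ba⊆Bb → proper adj (⁅⁆-injective (++-⊆ˡ ⁅ colour a ⁆ ⁅ colour b ⁆ Ba⊆Bb)))
      , (λ Bb⊆Ba → proper adj (sym (⁅⁆-injective (++-⊆ˡ ⁅ colour b ⁆ ⁅ colour a ⁆ Bb⊆Ba))))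

-- The vertex v of matching (M * 2) is the vertex side v of the pair half v.
module Matching (M : ℕ) where

  half : Fin (M * 2) → Fin M
  half = quotient {M} 2

  side : Fin (M * 2) → Fin 2
  side = remainder {M} 2

  half-combine : ∀ (k : Fin M) (r : Fin 2) → half (combine k r) ≡ k
  half-combine k r = cong proj₁ (remQuot-combine {M} {2} k r)

  side-combine : ∀ (k : Fin M) (r : Fin 2) → side (combine k r) ≡ r
  side-combine k r = cong proj₂ (remQuot-combine {M} {2} k r)

  vertex-≡ : ∀ {u v} → half u ≡ half v → side u ≡ side v → u ≡ v
  vertex-≡ {u} {v} hu≡hv su≡sv =
    trans (sym (combine-remQuot {M} 2 u)) (trans (cong₂ combine hu≡hv su≡sv) (combine-remQuot {M} 2 v))

  toℕ/2≡half : ∀ v → toℕ v / 2 ≡ toℕ (half v)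
  toℕ/2≡half v = begin
    toℕ v / 2                                 ≡⟨ /-congˡ (cong toℕ (combine-remQuot {M} 2 v)) ⟨
    toℕ (combine (half v) (side v)) / 2       ≡⟨ /-congˡ (toℕ-combine (half v) (side v)) ⟩
    (2 * toℕ (half v) + toℕ (side v)) / 2     ≡⟨ +-distrib-/-∣ˡ (toℕ (side v)) (m∣m*n (toℕ (half v))) ⟩
    2 * toℕ (half v) / 2 + toℕ (side v) / 2
      ≡⟨ cong₂ _+_ (trans (/-congˡ (*-comm 2 (toℕ (half v)))) (m*n/n≡m (toℕ (half v)) 2))
                   (m<n⇒m/n≡0 (toℕ<n (side v))) ⟩
    toℕ (half v) + 0                          ≡⟨ +-identityʳ (toℕ (half v)) ⟩
    toℕ (half v)                              ∎
    where open ≡-Reasoning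

  adjacent⇒ : ∀ {u v} → matchAdj u v → half u ≡ half v × side u ≢ side v
  adjacent⇒ {u} {v} (u≢v , u/2≡v/2) = hu≡hv , u≢v ∘ vertex-≡ hu≡hv
    where hu≡hv = toℕ-injective (trans (sym (toℕ/2≡half u)) (trans u/2≡v/2 (toℕ/2≡half v)))

  adjacent⇐ : ∀ {u v} → half u ≡ half v → side u ≢ side v → matchAdj u v
  adjacent⇐ {u} {v} hu≡hv su≢sv =
    su≢sv ∘ cong side , trans (toℕ/2≡half u) (trans (cong toℕ hu≡hv) (sym (toℕ/2≡half v)))

  x≢z∧y≢z⇒x≡y : ∀ {x y z : Fin 2} → x ≢ z → y ≢ z → x ≡ y
  x≢z∧y≢z⇒x≡y {zero}      {zero}      _ _ = refl
  x≢z∧y≢z⇒x≡y {suc zero}  {suc zero}  _ _ = refl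
  x≢z∧y≢z⇒x≡y {zero}      {suc zero}  {zero}     x≢z _ = contradiction refl x≢z
  x≢z∧y≢z⇒x≡y {zero}      {suc zero}  {suc zero} _ y≢z = contradiction refl y≢z
  x≢z∧y≢z⇒x≡y {suc zero}  {zero}      {zero}     _ y≢z = contradiction refl y≢z
  x≢z∧y≢z⇒x≡y {suc zero}  {zero}      {suc zero} x≢z _ = contradiction refl x≢z

  -- Each pair has exactly two vertices.
  half-≢ : ∀ {a b w} → matchAdj a b → w ≢ a → w ≢ b → half w ≢ half a
  half-≢ {a} {b} {w} adj w≢a w≢b hw≡ha with side w Finₚ.≟ side a
  ... | yes sw≡sa = w≢a (vertex-≡ hw≡ha sw≡sa)
  ... | no sw≢sa = w≢b (vertex-≡ (trans hw≡ha ha≡hb) (x≢z∧y≢z⇒x≡y sw≢sa (sa≢sb ∘ sym)))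
    where
    ha≡hb = proj₁ (adjacent⇒ adj)
    sa≢sb = proj₂ (adjacent⇒ adj)

  neighbour : ∀ v → ∃ (matchAdj v)
  neighbour v = combine (half v) (opposite (side v)) , adjacent⇐ (sym (half-combine _ _)) sv≢
    where
    opposite-≢ : ∀ (r : Fin 2) → r ≢ opposite r
    opposite-≢ zero ()
    opposite-≢ (suc zero) ()
    sv≢ = λ eq → opposite-≢ (side v) (trans eq (side-combine _ _))

  pairs-ECFF : ∀ {t} {A : Fin M → Subset t} → IsAntichain A → IsECFF (matching (M * 2)) (A ∘ half)
  pairs-ECFF {A = A} ac a b w adj w≢a w≢b Aw⊆ = ac (half w) (half a) (half-≢ adj w≢a w≢b)
    (subst (A (half w) ⊆_) (trans (cong (λ k → A (half a) ∪ A k) (sym (proj₁ (adjacent⇒ adj)))) (∪-idem _))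
           Aw⊆)

  ECFF-antichain : ∀ {t} {B : Family (M * 2) t} → IsECFF (matching (M * 2)) B →
                   IsAntichain (λ k → B (combine k zero))
  ECFF-antichain {B = B} ecff k l k≢l = ECFF-⊈ {G = matching (M * 2)} {B = B} ecff
    (adjacent⇐ (trans (half-combine l zero) (sym (half-combine l (suc zero))))
               (λ eq → case trans (sym (side-combine l zero)) (trans eq (side-combine l (suc zero))) of λ ()))
    (k≢l ∘ combine-injectiveˡ k zero l zero)
    (λ eq → case combine-injectiveʳ k zero l (suc zero) eq of λ ())

  ECFF⇒M≤central : ∀ {t} {B : Family (M * 2) t} → IsECFF (matching (M * 2)) B → M ≤ central t
  ECFF⇒M≤central ecff = sperner (ECFF-antichain ecff)

  CFF⇒M*2≤central : ∀ {t} {B : Family (M * 2) t} → IsCFF (matching (M * 2)) B → M * 2 ≤ central t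
  CFF⇒M*2≤central {B = B} cff = sperner (CFF-antichain {G = matching (M * 2)} {B = B} cff neighbour)

  ECFF-of-size : ∀ {t} → M ≤ central t → Σ (Family (M * 2) t) (IsECFF (matching (M * 2)))
  ECFF-of-size M≤central = let A , ac = antichain-of-size M≤central in A ∘ half , pairs-ECFF ac

  CFF-of-size : ∀ {t} → M ≤ central t → Σ (Family (M * 2) (2 + t)) (IsCFF (matching (M * 2)))
  CFF-of-size M≤central = let B , ecff = ECFF-of-size M≤central in
    tagged {G = matching (M * 2)} side (proj₂ ∘ adjacent⇒) B ,
    tagged-CFF {G = matching (M * 2)} side (proj₂ ∘ adjacent⇒) ecff

-- Vertices 0 and 1 form an edge, and no other set of a CFF lies in B 0 ∪ B 1.
CFF⇒M*2<central : ∀ {M t} {B : Family (suc M * 2) t} → 4 ≤ t → IsCFF (matching (suc M * 2)) B →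
                  suc M * 2 < central t
CFF⇒M*2<central {M} {B = B} 4≤t cff@(ecff , _) =
  sperner-strict (CFF-antichain {G = matching (suc M * 2)} {B = B} cff (Matching.neighbour (suc M)))
                 (λ w → ecff zero (suc zero) (suc (suc w)) ((λ ()) , refl) (λ ()) (λ ())) 4≤t

central[1+t]≡M*2⇒M≤central[t] : ∀ {M t} → central (suc t) ≡ M * 2 → M ≤ central t
central[1+t]≡M*2⇒M≤central[t] {M} {t} central≡M*2 = *-cancelʳ-≤ M (central t) 2 (begin
  M * 2              ≡⟨ central≡M*2 ⟨
  central (suc t)    ≤⟨ central-suc≤2*central t ⟩
  2 * central t      ≡⟨ *-comm 2 (central t) ⟩
  central t * 2      ∎)
  where open ≤-Reasoning

matching-te : ∀ {M} r → central (4 + r) ≡ M * 2 → IsTe (matching (M * 2)) (3 + r)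
matching-te {M} r central≡M*2 =
  Matching.ECFF-of-size M (central[1+t]≡M*2⇒M≤central[t] {t = 3 + r} central≡M*2) ,
  λ t (B , ecff) → ≮⇒≥ λ t<3+r → <-irrefl refl (begin-strict
    M * 2                ≤⟨ *-monoˡ-≤ 2 (≤-trans (Matching.ECFF⇒M≤central M ecff) (central-mono-≤ (≤-pred t<3+r))) ⟩
    central (2 + r) * 2  ≡⟨ *-comm (central (2 + r)) 2 ⟩
    2 * central (2 + r)  <⟨ 2*central[1+n]<central[3+n] (suc r) ⟩
    central (4 + r)      ≡⟨ central≡M*2 ⟩
    M * 2                ∎)
  where open ≤-Reasoning

matching-t : ∀ {M} r → central (4 + r) ≡ M * 2 → IsT (matching (M * 2)) (4 + r + 1)
matching-t {zero} r central≡0 = contradiction central≡0 (≢-nonZero⁻¹ _ {{central≢0 (4 + r)}})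
matching-t {M@(suc M′)} r central≡M*2 =
  subst (λ t → Σ (Family (M * 2) t) (IsCFF (matching (M * 2)))) (cong (4 +_) (+-comm 1 r))
        (Matching.CFF-of-size M (central[1+t]≡M*2⇒M≤central[t] {t = 3 + r} central≡M*2)) ,
  λ t (B , cff) → ≮⇒≥ λ t<5+r →
    <-irrefl (sym central≡M*2) (lower t B cff (≤-pred (subst (t <_) (+-comm (4 + r) 1) t<5+r)))
  where
  open ≤-Reasoning
  lower : ∀ t (B : Family (M * 2) t) → IsCFF (matching (M * 2)) B → t ≤ 4 + r → M * 2 < central (4 + r)
  lower t B cff t≤4+r with 4 ≤? t
  ... | yes 4≤t = <-≤-trans (CFF⇒M*2<central {M′} {B = B} 4≤t cff) (central-mono-≤ t≤4+r)
  ... | no 4≰t = begin-strict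
    M * 2             ≤⟨ Matching.CFF⇒M*2≤central M cff ⟩
    central t         ≤⟨ central-mono-≤ (≤-pred (≰⇒> 4≰t)) ⟩
    central 3         <⟨ central-<-suc 2 ⟩
    central 4         ≤⟨ central-mono-≤ (m≤m+n 4 r) ⟩
    central (4 + r)   ∎

theorem5p10 : (x : ℕ) → 4 ≤ x → 2 ∣ (x C (x / 2)) →
    Σ ℕ (λ te → IsTe (matching (x C (x / 2))) te
      × IsT (matching (x C (x / 2))) (x + 1)
      × x + 1 ≡ te + 2)
theorem5p10 _ (s≤s (s≤s (s≤s (s≤s (z≤n {r}))))) (divides M binomial≡M*2) =
  3 + r ,
  subst (λ N → IsTe (matching N) (3 + r)) (sym binomial≡M*2) (matching-te {M} r central≡M*2) ,
  subst (λ N → IsT (matching N) (4 + r + 1)) (sym binomial≡M*2) (matching-t {M} r central≡M*2) ,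
  cong (3 +_) (sym (+-suc r 1))
  where
  central≡M*2 : central (4 + r) ≡ M * 2
  central≡M*2 = trans (cong ((4 + r) C_) (sym (n/2≡⌊n/2⌋ (4 + r)))) binomial≡M*2
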